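{- For every chip configuration $D\ge 0$ on $G$ and every $k$ with $0\le k\le n-1$, at least one $k$-stabilization of $D$ exists.
   Context: Let $a,b,c$ be positive integers. Let $G$ be a simple undirected graph with vertex set $\{0\}\cup[n]$ ($0$ is the sink) such that $\{0,i\}$ is an edge for every $i\in[n]$. For $i\in[n]$ let $N(i)$ be its set of non-sink neighbors and, for $X\subseteq[n]$, $\deg_X(i)=|N(i)\cap X|$; write $\overline{X}=[n]\setminus X$. A chip configuration is $D:[n]\to\mathbb{Z}$; $D\ge0$ means all values are nonnegative. For $S\subseteq[n]$, $\phi_S(D)$ is obtained from $D$ by subtracting $c+\lfloor \deg_{\overline S}(i)\,a/b\rfloor$ from $D(i)$ for each $i\in S$ and adding $\lfloor \deg_S(j)\,a/b\rfloor$ to $D(j)$ for each $j\in\overline S$. For $D\ge0$, $\phi_S$ is legal on $D$ if $\phi_S(D)\ge0$. A $k$-firing move is $\phi_S$ with $0<|S|\le k+1$. $D\ge 0$ is $k$-stable if no $k$-firing move is legal on $D$. A $k$-stabilization of $D\ge0$ is a $k$-stable configuration obtained from $D$ by a finite sequence of $k$-firing moves, each legal on the configuration to which it is applied. -}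

module Defs where

open import Data.Nat using (ℕ; zero; suc; _*_; _≤_; _<_; NonZero)
open import Data.Nat.DivMod using (_/_)
open import Data.Bool using (Bool; true; false; if_then_else_; _∧_)
open import Data.Fin using (Fin)
open import Data.Fin.Subset using (Subset; ∁; ∣_∣)
open import Data.Vec using (lookup)
open import Data.List using (List; filter; length)
open import Data.Fin using () renaming (_≟_ to _≟ᶠ_)
open import Data.List using () renaming (allFin to allFinL)
open import Data.Integer using (ℤ; +_; _-_) renaming (_+_ to _+ℤ_; _≤_ to _≤ℤ_)
open import Data.Product using (Σ; _×_; ∃-syntax)
open import Relation.Nullary using (¬_)
open import Relation.Binary.PropositionalEquality using (_≡_)
open import Relation.Binary.Construct.Closure.ReflexiveTransitive using (Star)
open import Relation.Nullary.Decidable using (does)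
open import Data.Bool using (T)

-- A simple graph on the non-sink vertices [n] = Fin n; the sink 0 is implicit
-- and adjacent to every non-sink vertex (so it does not need to be stored).
record Graph (n : ℕ) : Set where
  field
    adj   : Fin n → Fin n → Bool
    sym   : ∀ i j → adj i j ≡ adj j i
    irrefl : ∀ i → adj i i ≡ false
open Graph public

Config : ℕ → Set
Config n = Fin n → ℤ

NonNeg : ∀ {n} → Config n → Set
NonNeg D = ∀ i → + 0 ≤ℤ D i

deg : ∀ {n} → Graph n → Subset n → Fin n → ℕ
deg G X i = length (filter (λ j → T? (lookup X j ∧ adj G i j)) (allFinL _))
  where
  open import Data.Bool.Properties using () renaming (T? to T?)

φ : ∀ {n} (a b c : ℕ) → .{{_ : NonZero b}} → Graph n → Subset n → Config n → Config n
φ a b c G S D i =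
  if lookup S i
  then D i - (+ (c Data.Nat.+ (deg G (∁ S) i * a) / b))
  else D i +ℤ (+ ((deg G S i * a) / b))
  where import Data.Nat

KFiringSet : ∀ {n} → ℕ → Subset n → Set
KFiringSet k S = 0 < ∣ S ∣ × ∣ S ∣ ≤ suc k

Legal : ∀ {n} (a b c : ℕ) → .{{_ : NonZero b}} → Graph n → Subset n → Config n → Set
Legal a b c G S D = NonNeg (φ a b c G S D)

data KMove {n} (a b c : ℕ) .{{_ : NonZero b}} (G : Graph n) (k : ℕ)
     : Config n → Config n → Set where
  move : ∀ {D} (S : Subset n) → KFiringSet k S → NonNeg D → Legal a b c G S D →
         KMove a b c G k D (φ a b c G S D)

KStable : ∀ {n} (a b c : ℕ) → .{{_ : NonZero b}} → Graph n → ℕ → Config n → Set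
KStable {n} a b c G k D =
  NonNeg D × (∀ (S : Subset n) → KFiringSet k S → ¬ Legal a b c G S D)

KStabilization : ∀ {n} (a b c : ℕ) → .{{_ : NonZero b}} → Graph n → ℕ →
                 Config n → Config n → Set
KStabilization a b c G k D D' =
  Star (KMove a b c G k) D D' × KStable a b c G k D'

-- Firing a nonempty set S legally strictly decreases the total number of chips.  A vertex i
-- of S loses c + ⌊deg_S̄(i)·a/b⌋ > deg_S̄(i)·a/b chips (as c ≥ 1), a vertex j outside S gains
-- ⌊deg_S(j)·a/b⌋ ≤ deg_S(j)·a/b, and both bounds sum to a/b times the number of edges between
-- S and S̄.  So k-firing moves are strongly normalising, and since it is decidable whether a
-- move exists, repeatedly firing reaches a k-stable configuration.
module Submission where

open import Defs
open import Data.Nat using (ℕ; _<_; NonZero)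
open import Data.Product using (∃-syntax)

open import Data.Bool using (Bool; true; false; if_then_else_; _∧_; not)
open import Data.Bool.Properties using (T?; ∧-assoc; ∧-comm)
open import Data.Fin using (Fin; zero; suc)
open import Data.Fin.Subset using (Subset; ∁; ∣_∣)
open import Data.Fin.Subset.Properties using (anySubset?)
open import Data.Fin.Properties using (all?)
open import Data.Integer using (ℤ; +_; +≤+; _-_; 0ℤ)
  renaming (∣_∣ to abs; _+_ to _+ℤ_; _≤_ to _≤ℤ_; _≤?_ to _≤ℤ?_)
open import Data.Integer.Properties using (+-0-abelianGroup)
open import Data.List using (filter; length; tabulate)
open import Data.Nat using (suc; _+_; _*_; _≤_; z≤n; _≤?_; _<?_; >-nonZero)
open import Data.Nat.DivMod using (_/_; _%_; m%n<n; m/n*n≤m; m≡m%n+[m/n]*n)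
open import Data.Nat.Induction using (<-wellFounded)
open import Data.Nat.Properties
open import Data.Product using (_×_; _,_)
open import Data.Vec using (lookup; _∷_; [])
open import Data.Vec.Properties using (lookup-map)
open import Function using (_∘_; flip; id)
open import Induction.WellFounded using (Acc; acc; module Subrelation)
import Relation.Binary.Construct.On as On
open import Relation.Binary.Construct.Closure.ReflexiveTransitive using (Star; ε; _◅_)
open import Relation.Binary.PropositionalEquality as ≡
  using (_≡_; refl; trans; cong; module ≡-Reasoning)
open import Relation.Binary.Rewriting using (IsNormalForm; StronglyNormalizing; WeaklyNormalizing)
open import Relation.Nullary using (Dec; yes; no)
open import Relation.Nullary.Decidable using (_×-dec_)

open import Algebra.Properties.AbelianGroup +-0-abelianGroup using (//-rightDividesˡ)
import Algebra.Properties.CommutativeMonoid.Sum as MonoidSum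
import Algebra.Properties.Semiring.Sum as SemiringSum

open MonoidSum +-0-commutativeMonoid
  using (sum-syntax; ∑-comm; ∑-distrib-+; sum-cong-≗; sum-replicate-zero)
open SemiringSum +-*-semiring using (*-distribʳ-sum)

sn∧dec⇒wn : ∀ {A : Set} {_⟶_ : A → A → Set} →
            StronglyNormalizing _⟶_ → (∀ x → Dec (∃[ y ] x ⟶ y)) → WeaklyNormalizing _⟶_
sn∧dec⇒wn {_⟶_ = _⟶_} sn step? x = go x (sn x)
  where
  go : ∀ x → Acc (flip _⟶_) x → ∃[ y ] IsNormalForm _⟶_ y × Star _⟶_ x y
  go x (acc rs) with step? x
  ... | no nf = x , nf , ε
  ... | yes (y , x⟶y) with go y (rs x⟶y)
  ...   | z , z-nf , y⟶*z = z , z-nf , x⟶y ◅ y⟶*z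

decreasing⇒sn : ∀ {A : Set} {_⟶_ : A → A → Set} (μ : A → ℕ) →
                (∀ {x y} → x ⟶ y → μ y < μ x) → StronglyNormalizing _⟶_
decreasing⇒sn μ decreasing =
  Subrelation.wellFounded decreasing (On.wellFounded μ <-wellFounded)

𝟙 : Bool → ℕ
𝟙 true  = 1
𝟙 false = 0

∑-mono-≤ : ∀ {n} {f g : Fin n → ℕ} → (∀ i → f i ≤ g i) → ∑[ i < n ] f i ≤ ∑[ i < n ] g i
∑-mono-≤ {0}     f≤g = z≤n
∑-mono-≤ {suc n} f≤g = +-mono-≤ (f≤g zero) (∑-mono-≤ (f≤g ∘ suc))

length-filter-tabulate : ∀ {n} {A : Set} (p : A → Bool) (f : Fin n → A) →
                         length (filter (T? ∘ p) (tabulate f)) ≡ ∑[ i < n ] 𝟙 (p (f i))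
length-filter-tabulate {0}     p f = refl
length-filter-tabulate {suc n} p f with p (f zero)
... | true  = cong suc (length-filter-tabulate p (f ∘ suc))
... | false = length-filter-tabulate p (f ∘ suc)

∑-𝟙-lookup≡∣∣ : ∀ {n} (S : Subset n) → ∑[ i < n ] 𝟙 (lookup S i) ≡ ∣ S ∣
∑-𝟙-lookup≡∣∣ []          = refl
∑-𝟙-lookup≡∣∣ (true ∷ S)  = cong suc (∑-𝟙-lookup≡∣∣ S)
∑-𝟙-lookup≡∣∣ (false ∷ S) = ∑-𝟙-lookup≡∣∣ S

module _ {n} (G : Graph n) where

  deg≡∑ : ∀ X i → deg G X i ≡ ∑[ j < n ] 𝟙 (lookup X j ∧ adj G i j)
  deg≡∑ X i = length-filter-tabulate (λ j → lookup X j ∧ adj G i j) id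

  edgesBetween : Subset n → Subset n → ℕ
  edgesBetween X Y = ∑[ i < n ] ∑[ j < n ] 𝟙 (lookup X i ∧ (lookup Y j ∧ adj G i j))

  edgesBetween-sym : ∀ X Y → edgesBetween X Y ≡ edgesBetween Y X
  edgesBetween-sym X Y = trans (∑-comm edge) (sum-cong-≗ λ j → sum-cong-≗ λ i →
    cong 𝟙 (swap (lookup X i) (lookup Y j) (Graph.sym G i j)))
    where
    edge : Fin n → Fin n → ℕ
    edge i j = 𝟙 (lookup X i ∧ (lookup Y j ∧ adj G i j))

    swap : ∀ x y {e e′} → e ≡ e′ → x ∧ (y ∧ e) ≡ y ∧ (x ∧ e′)
    swap x y refl = begin
      x ∧ (y ∧ _) ≡⟨ ≡.sym (∧-assoc x y _) ⟩
      (x ∧ y) ∧ _ ≡⟨ cong (_∧ _) (∧-comm x y) ⟩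
      (y ∧ x) ∧ _ ≡⟨ ∧-assoc y x _ ⟩
      y ∧ (x ∧ _) ∎
      where open ≡-Reasoning

  edgesBetween≡∑deg : ∀ X Y → edgesBetween X Y ≡ ∑[ i < n ] (if lookup X i then deg G Y i else 0)
  edgesBetween≡∑deg X Y = sum-cong-≗ row
    where
    row : ∀ i → ∑[ j < n ] 𝟙 (lookup X i ∧ (lookup Y j ∧ adj G i j))
              ≡ (if lookup X i then deg G Y i else 0)
    row i with lookup X i
    ... | true  = ≡.sym (deg≡∑ Y i)
    ... | false = sum-replicate-zero n

m<[1+m/n]*n : ∀ m n .{{_ : NonZero n}} → m < suc (m / n) * n
m<[1+m/n]*n m n = begin-strict
  m                 ≡⟨ m≡m%n+[m/n]*n m n ⟩
  m % n + m / n * n <⟨ +-monoˡ-< (m / n * n) (m%n<n m n) ⟩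
  n + m / n * n     ∎
  where open ≤-Reasoning

∣i+n∣≡∣i∣+n : ∀ {i} n → 0ℤ ≤ℤ i → abs (i +ℤ + n) ≡ abs i + n
∣i+n∣≡∣i∣+n n (+≤+ _) = refl

totalChips : ∀ {n} → Config n → ℕ
totalChips {n} D = ∑[ i < n ] abs (D i)

module Firing (a b c : ℕ) .{{_ : NonZero b}} {n} (G : Graph n) (S : Subset n) where

  loss : Fin n → ℕ
  loss i = if lookup S i then c + deg G (∁ S) i * a / b else 0

  gain : Fin n → ℕ
  gain i = if lookup S i then 0 else deg G S i * a / b

  ∣φ∣+loss≡∣D∣+gain : ∀ D → NonNeg D → Legal a b c G S D →
                      ∀ i → abs (φ a b c G S D i) + loss i ≡ abs (D i) + gain i
  ∣φ∣+loss≡∣D∣+gain D D≥0 φD≥0 i with lookup S i | φD≥0 i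
  ... | true  | x≥0 = begin
    abs x + m          ≡⟨ ∣i+n∣≡∣i∣+n m x≥0 ⟨
    abs (x +ℤ + m)     ≡⟨ cong abs (//-rightDividesˡ (+ m) (D i)) ⟩
    abs (D i)          ≡⟨ +-identityʳ _ ⟨
    abs (D i) + 0      ∎
    where
    open ≡-Reasoning
    m : ℕ
    m = c + deg G (∁ S) i * a / b
    x : ℤ
    x = D i - + m
  ... | false | _   = trans (+-identityʳ _) (∣i+n∣≡∣i∣+n _ (D≥0 i))

  outflow : Fin n → ℕ
  outflow i = if lookup S i then deg G (∁ S) i else 0

  inflow : Fin n → ℕ
  inflow i = if lookup (∁ S) i then deg G S i else 0

  outflow*a+𝟙≤loss*b : 0 < c → ∀ i → outflow i * a + 𝟙 (lookup S i) ≤ loss i * b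
  outflow*a+𝟙≤loss*b c>0 i with lookup S i
  ... | false = z≤n
  ... | true  = begin
    d * a + 1                    ≡⟨ +-comm (d * a) 1 ⟩
    suc (d * a)                  ≤⟨ m<[1+m/n]*n (d * a) b ⟩
    b + d * a / b * b            ≤⟨ +-monoˡ-≤ _ (m≤n*m b c {{>-nonZero c>0}}) ⟩
    c * b + d * a / b * b        ≡⟨ *-distribʳ-+ b c _ ⟨
    (c + d * a / b) * b          ∎
    where
    open ≤-Reasoning
    d : ℕ
    d = deg G (∁ S) i

  gain*b≤inflow*a : ∀ i → gain i * b ≤ inflow i * a
  gain*b≤inflow*a i rewrite lookup-map i not S with lookup S i
  ... | true  = z≤n
  ... | false = m/n*n≤m (deg G S i * a) b

  ∑gain<∑loss : 0 < c → 0 < ∣ S ∣ → ∑[ i < n ] gain i < ∑[ i < n ] loss i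
  ∑gain<∑loss c>0 ∣S∣>0 = *-cancelʳ-< b _ _ (begin-strict
    (∑[ i < n ] gain i) * b                        ≡⟨ *-distribʳ-sum b gain ⟩
    ∑[ i < n ] (gain i * b)                        ≤⟨ ∑-mono-≤ gain*b≤inflow*a ⟩
    ∑[ i < n ] (inflow i * a)                      ≡⟨ *-distribʳ-sum a inflow ⟨
    (∑[ i < n ] inflow i) * a                      ≡⟨ cong (_* a) handshake ⟩
    (∑[ i < n ] outflow i) * a                     <⟨ m<m+n _ ∣S∣>0 ⟩
    (∑[ i < n ] outflow i) * a + ∣ S ∣             ≡⟨ cong (_+_ _) (∑-𝟙-lookup≡∣∣ S) ⟨
    (∑[ i < n ] outflow i) * a + ∑[ i < n ] 𝟙 (lookup S i)
                                                   ≡⟨ cong (_+ _) (*-distribʳ-sum a outflow) ⟩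
    ∑[ i < n ] (outflow i * a) + ∑[ i < n ] 𝟙 (lookup S i)
                                                   ≡⟨ ∑-distrib-+ (λ i → outflow i * a) _ ⟨
    ∑[ i < n ] (outflow i * a + 𝟙 (lookup S i))    ≤⟨ ∑-mono-≤ (outflow*a+𝟙≤loss*b c>0) ⟩
    ∑[ i < n ] (loss i * b)                        ≡⟨ *-distribʳ-sum b loss ⟨
    (∑[ i < n ] loss i) * b                        ∎)
    where
    open ≤-Reasoning
    handshake : ∑[ i < n ] inflow i ≡ ∑[ i < n ] outflow i
    handshake = begin-equality
      ∑[ i < n ] inflow i     ≡⟨ edgesBetween≡∑deg G (∁ S) S ⟨
      edgesBetween G (∁ S) S  ≡⟨ edgesBetween-sym G (∁ S) S ⟩
      edgesBetween G S (∁ S)  ≡⟨ edgesBetween≡∑deg G S (∁ S) ⟩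
      ∑[ i < n ] outflow i    ∎

  totalChips-φ< : 0 < c → 0 < ∣ S ∣ → ∀ {D} → NonNeg D → Legal a b c G S D →
                  totalChips (φ a b c G S D) < totalChips D
  totalChips-φ< c>0 ∣S∣>0 {D} D≥0 φD≥0 = +-cancelʳ-< (∑[ i < n ] loss i) _ _ (begin-strict
    totalChips φD + ∑[ i < n ] loss i            ≡⟨ ∑-distrib-+ (abs ∘ φD) loss ⟨
    ∑[ i < n ] (abs (φD i) + loss i)             ≡⟨ sum-cong-≗ (∣φ∣+loss≡∣D∣+gain D D≥0 φD≥0) ⟩
    ∑[ i < n ] (abs (D i) + gain i)              ≡⟨ ∑-distrib-+ (abs ∘ D) gain ⟩
    totalChips D + ∑[ i < n ] gain i             <⟨ +-monoʳ-< _ (∑gain<∑loss c>0 ∣S∣>0) ⟩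
    totalChips D + ∑[ i < n ] loss i             ∎)
    where
    open ≤-Reasoning
    φD : Config n
    φD = φ a b c G S D

module KFiring (a b c : ℕ) .{{_ : NonZero b}} {n} (G : Graph n) (k : ℕ) where

  _⟶_ : Config n → Config n → Set
  _⟶_ = KMove a b c G k

  totalChips-decreasing : 0 < c → ∀ {D D′} → D ⟶ D′ → totalChips D′ < totalChips D
  totalChips-decreasing c>0 (move S (∣S∣>0 , _) D≥0 φD≥0) =
    Firing.totalChips-φ< a b c G S c>0 ∣S∣>0 D≥0 φD≥0

  nonNeg? : (D : Config n) → Dec (NonNeg D)
  nonNeg? D = all? (λ i → + 0 ≤ℤ? D i)

  kFiringSet? : (S : Subset n) → Dec (KFiringSet k S)
  kFiringSet? S = (0 <? ∣ S ∣) ×-dec (∣ S ∣ ≤? suc k)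

  legalKFiring? : ∀ D (S : Subset n) → Dec (KFiringSet k S × Legal a b c G S D)
  legalKFiring? D S = kFiringSet? S ×-dec nonNeg? (φ a b c G S D)

  move? : ∀ D → Dec (∃[ D′ ] D ⟶ D′)
  move? D with nonNeg? D | anySubset? (legalKFiring? D)
  ... | yes D≥0 | yes (S , firing , legal) = yes (_ , move S firing D≥0 legal)
  ... | no D≱0  | _                         = no λ { (_ , move _ _ D≥0 _) → D≱0 D≥0 }
  ... | _       | no stuck                  = no λ { (_ , move S firing _ legal) → stuck (S , firing , legal) }

  NonNeg-⟶* : ∀ {D D′} → NonNeg D → Star _⟶_ D D′ → NonNeg D′
  NonNeg-⟶* D≥0 ε                        = D≥0
  NonNeg-⟶* _   (move _ _ _ φD≥0 ◅ steps) = NonNeg-⟶* φD≥0 steps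

  isNormalForm⇒KStable : ∀ {D} → NonNeg D → IsNormalForm _⟶_ D → KStable a b c G k D
  isNormalForm⇒KStable D≥0 normal = D≥0 , λ S firing legal → normal (_ , move S firing D≥0 legal)

proposition2p4 : (a b c : ℕ) → 0 < a → 0 < b → 0 < c → .{{_ : NonZero b}} → (n : ℕ) → (G : Graph n) → (D : Config n) → NonNeg D → (k : ℕ) → k < n → ∃[ D' ] KStabilization a b c G k D D'
proposition2p4 a b c _ _ c>0 n G D D≥0 k _ =
  let D′ , normal , D⟶*D′ = weaklyNormalizing D
  in  D′ , D⟶*D′ , isNormalForm⇒KStable (NonNeg-⟶* D≥0 D⟶*D′) normal
  where
  open KFiring a b c G k
  weaklyNormalizing : WeaklyNormalizing _⟶_
  weaklyNormalizing = sn∧dec⇒wn (decreasing⇒sn totalChips (totalChips-decreasing c>0)) move?
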